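{- Let $S_n$ be the star tree on $n\geq 3$ vertices. Then $$\det(xI-\mathrm{Max4PC}_{S_n}) = x^{\binom{n}{2}-2}\left(x^2-2(n-1)^2x-(n-1)\binom{n-1}{2}\right),$$ and the nonzero eigenvalues of $\mathrm{Max4PC}_{S_n}$ are $(n-1)^2 \pm \sqrt{(n-1)^4+(n-1)\binom{n-1}{2}}$.
   Context: For a tree $T$ and vertices $x,y$, $d_{x,y}$ denotes the distance between $x$ and $y$ in $T$. $\mathrm{Max4PC}_T$ is the $\binom{n}{2}\times\binom{n}{2}$ matrix with rows and columns indexed by unordered pairs of distinct vertices of $T$, with entry in row $\{w,x\}$ and column $\{y,z\}$ equal to $\max\{d_{w,x}+d_{y,z},\ d_{w,y}+d_{x,z},\ d_{w,z}+d_{x,y}\}$. The star tree $S_n$ has one vertex adjacent to all other $n-1$ vertices, which are leaves. -}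

module Defs where

open import Data.Nat as ℕ using (ℕ; zero; suc; _⊔_)
open import Data.Integer as ℤ using (ℤ; +_; -_; _-_; _*_; _+_)
open import Data.Fin as Fin using (Fin; toℕ; punchIn)
open import Data.Fin.Properties using (_≟_)
open import Data.List as List using (List; allFin; filter; cartesianProduct; length; lookup; foldr)
open import Data.Product using (_×_; _,_; proj₁; proj₂)
open import Relation.Nullary using (yes; no)

Matrix : ℕ → Set
Matrix m = Fin m → Fin m → ℤ

sgn : ℕ → ℤ
sgn zero = + 1
sgn (suc k) = - sgn k

det : ∀ {m} → Matrix m → ℤ
det {zero} A = + 1
det {suc m} A =
  foldr _+_ (+ 0)
    (List.map (λ j → sgn (toℕ j) * A Fin.zero j * det (λ r c → A (Fin.suc r) (punchIn j c)))
              (allFin (suc m)))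

xI-_at_ : ∀ {m} → Matrix m → ℤ → Matrix m
(xI- A at x) i j with i ≟ j
... | yes _ = x - A i j
... | no  _ = + 0 - A i j

-- Unordered pairs {a,b} of distinct vertices of Fin n, represented as (a,b) with a < b.
-- (Any fixed enumeration works: the determinant is invariant under simultaneous
-- permutation of rows and columns.)
pairs : (n : ℕ) → List (Fin n × Fin n)
pairs n = filter (λ p → toℕ (proj₁ p) ℕ.<? toℕ (proj₂ p)) (cartesianProduct (allFin n) (allFin n))

P : ℕ → ℕ
P n = length (pairs n)

pair : (n : ℕ) → Fin (P n) → Fin n × Fin n
pair n k = lookup (pairs n) k

Max4PC : (n : ℕ) → (Fin n → Fin n → ℕ) → Matrix (P n)
Max4PC n d r c with pair n r | pair n c
... | (w , x) | (y , z) = + ((d w x ℕ.+ d y z) ⊔ (d w y ℕ.+ d x z) ⊔ (d w z ℕ.+ d x y))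

starDist : (n : ℕ) → Fin n → Fin n → ℕ
starDist n u v with u ≟ v
... | yes _ = 0
... | no _ with toℕ u | toℕ v
...   | zero | _ = 1
...   | suc _ | zero = 1
...   | suc _ | suc _ = 2

-- Listing the n − 1 pairs through the centre first, the entry of Max4PC(Sₙ) at {w,x}, {y,z}
-- (w < x, y < z) is 2 + [w is a leaf] + [y is a leaf]: x and z are leaves, so d(w,x) + d(y,z) is the
-- largest of the three sums. So Max4PC(Sₙ) is constant on the blocks of a partition of sizes
-- K = n − 1 and B = C(n−1, 2), with values 2, 3, 3, 4. For such a matrix, det (xI − M) is computed
-- by collapsing rows: if p·row₀ = q·row₁ outside columns 0 and 1, one Laplace step lowers the size by
-- one. Collapsing two rows of the first block gives a factor x and moves weight onto column 0; the last
-- first-block row is collapsed against the second block (p = 4, q = 3), after which every further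
-- collapse again gives a factor x. What survives is the characteristic polynomial (x − 2K)(x − 4B) − 9KB
-- of the 2×2 quotient matrix, and 2B = K(K − 1) turns it into x² − 2(n−1)²x − (n−1)·C(n−1, 2).

module Submission where

open import Defs
open import Data.Nat as ℕ using (ℕ; _≤_; _∸_)
open import Data.Nat.Combinatorics using (_C_)
open import Data.Integer as ℤ using (ℤ; +_; _-_; _*_; _^_)
open import Relation.Binary.PropositionalEquality using (_≡_)

open import Data.Nat using (zero; suc; _⊔_; _<ᵇ_; _≡ᵇ_)
import Data.Nat.Properties as ℕ
import Data.Nat.Tactic.RingSolver as ℕ-Solver
open import Data.Nat.Combinatorics using (nCk+nC[k+1]≡[n+1]C[k+1]; nC1≡n)
open import Data.Bool using (Bool; true; false)
open import Data.Integer using (-_; _+_)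
open import Data.Integer.Properties
  using ( +-*-semiring; pos-*; ^-distribˡ-+-*; ^-identityʳ; *-zeroʳ; *-identityˡ; *-assoc
        ; +-identityʳ; +-assoc; +-inverseʳ; neg-distribˡ-*; *-cancelˡ-≡)
open import Data.Integer.Tactic.RingSolver using (solve-∀)
open import Data.Fin as Fin using (Fin; toℕ; punchIn)
open import Data.Fin.Properties using (_≟_)
open import Data.List as List using (List; []; _∷_; _++_; allFin; foldr; filter; cartesianProduct; length; lookup)
open import Data.List.Properties using (filter-++; filter-all; map-++; map-tabulate; length-map; length-tabulate; length-++)
import Data.List.Relation.Unary.All as All
open import Data.List.Relation.Unary.All using (All; []; _∷_)
open import Data.List.Relation.Unary.All.Properties using (map⁺; tabulate⁺; all-filter)
open import Data.List.Membership.Propositional.Properties using (∈-lookup)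
open import Data.Product as Product using (_×_; _,_; proj₁; proj₂)
open import Function using (_∘_)
open import Relation.Nullary using (Dec; yes; no; contradiction)
open import Relation.Binary.PropositionalEquality using (_≢_; refl; sym; trans; cong; cong₂; module ≡-Reasoning)
open import Algebra.Properties.Semiring.Sum +-*-semiring
  using (sum; sum-cong-≗; ∑-comm; ∑-distrib-+; *-distribˡ-sum; sum-replicate-zero)

open ≡-Reasoning

pattern 0F = Fin.zero
pattern 1F = Fin.suc Fin.zero

minor₀ⱼ : ∀ {m} → Fin (suc m) → Matrix (suc m) → Matrix m
minor₀ⱼ j A r c = A (Fin.suc r) (punchIn j c)

minorᵢ₀ : ∀ {m} → Fin (suc m) → Matrix (suc m) → Matrix m
minorᵢ₀ i A r c = A (punchIn i r) (Fin.suc c)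

foldr-+-map-tabulate : ∀ {m} {B : Set} (f : B → ℤ) (g : Fin m → B) →
  foldr _+_ (+ 0) (List.map f (List.tabulate g)) ≡ sum (f ∘ g)
foldr-+-map-tabulate {zero}  f g = refl
foldr-+-map-tabulate {suc m} f g = cong (_+_ (f (g 0F))) (foldr-+-map-tabulate f (g ∘ Fin.suc))

det-expandRow₀ : ∀ {m} (A : Matrix (suc m)) →
  det A ≡ sum (λ j → sgn (toℕ j) * A 0F j * det (minor₀ⱼ j A))
det-expandRow₀ A = foldr-+-map-tabulate (λ j → sgn (toℕ j) * A 0F j * det (minor₀ⱼ j A)) (λ j → j)

det-cong : ∀ {m} {A B : Matrix m} → (∀ r c → A r c ≡ B r c) → det A ≡ det B
det-cong {zero}  A≗B = refl
det-cong {suc m} {A} {B} A≗B = begin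
  det A
    ≡⟨ det-expandRow₀ A ⟩
  sum (λ j → sgn (toℕ j) * A 0F j * det (minor₀ⱼ j A))
    ≡⟨ sum-cong-≗ (λ j → cong₂ (λ a d → sgn (toℕ j) * a * d)
                                (A≗B 0F j) (det-cong (λ r c → A≗B (Fin.suc r) (punchIn j c)))) ⟩
  sum (λ j → sgn (toℕ j) * B 0F j * det (minor₀ⱼ j B))
    ≡⟨ det-expandRow₀ B ⟨
  det B ∎

det-expandCol₀ : ∀ {m} (A : Matrix (suc m)) →
  det A ≡ sum (λ i → sgn (toℕ i) * A i 0F * det (minorᵢ₀ i A))
det-expandCol₀ {zero}  A = det-expandRow₀ A
det-expandCol₀ {suc m} A = trans (det-expandRow₀ A) (cong (_+_ (sgn 0 * A 0F 0F * det (minor₀ⱼ 0F A))) (begin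
  sum (λ j → - sgn (toℕ j) * a j * det (minor₀ⱼ (Fin.suc j) A))
    ≡⟨ sum-cong-≗ (λ j → cong (- sgn (toℕ j) * a j *_) (det-expandCol₀ (minor₀ⱼ (Fin.suc j) A))) ⟩
  sum (λ j → - sgn (toℕ j) * a j * sum (λ i → sgn (toℕ i) * b i * N i j))
    ≡⟨ sum-cong-≗ (λ j → *-distribˡ-sum (- sgn (toℕ j) * a j) (λ i → sgn (toℕ i) * b i * N i j)) ⟩
  sum (λ j → sum (λ i → - sgn (toℕ j) * a j * (sgn (toℕ i) * b i * N i j)))
    ≡⟨ sum-cong-≗ (λ j → sum-cong-≗ (λ i → swap (sgn (toℕ j)) (a j) (sgn (toℕ i)) (b i) (N i j))) ⟩
  sum (λ j → sum (λ i → - sgn (toℕ i) * b i * (sgn (toℕ j) * a j * N i j)))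
    ≡⟨ ∑-comm (λ j i → - sgn (toℕ i) * b i * (sgn (toℕ j) * a j * N i j)) ⟩
  sum (λ i → sum (λ j → - sgn (toℕ i) * b i * (sgn (toℕ j) * a j * N i j)))
    ≡⟨ sum-cong-≗ (λ i → sym (*-distribˡ-sum (- sgn (toℕ i) * b i) (λ j → sgn (toℕ j) * a j * N i j))) ⟩
  sum (λ i → - sgn (toℕ i) * b i * sum (λ j → sgn (toℕ j) * a j * N i j))
    ≡⟨ sum-cong-≗ (λ i → cong (- sgn (toℕ i) * b i *_) (sym (det-expandRow₀ (minorᵢ₀ (Fin.suc i) A)))) ⟩
  sum (λ i → - sgn (toℕ i) * b i * det (minorᵢ₀ (Fin.suc i) A)) ∎))
  where
  a b : Fin (suc m) → ℤ
  a j = A 0F (Fin.suc j)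
  b i = A (Fin.suc i) 0F
  N : Fin (suc m) → Fin (suc m) → ℤ
  N i j = det (λ r c → A (Fin.suc (punchIn i r)) (Fin.suc (punchIn j c)))
  swap : ∀ sj aj si bi n → - sj * aj * (si * bi * n) ≡ - si * bi * (sj * aj * n)
  swap = solve-∀

mutual
  det-equalRows₀₁ : ∀ {m} (A : Matrix (suc (suc m))) → (∀ c → A 0F c ≡ A 1F c) → det A ≡ + 0
  det-equalRows₀₁ {m} A row₀≡row₁ = begin
    det A
      ≡⟨ det-expandCol₀ A ⟩
    term 0F + (term 1F + sum (term ∘ Fin.suc ∘ Fin.suc))
      ≡⟨ cong₂ (λ u v → u + (term 1F + v)) term₀≡ other-terms-vanish ⟩
    + 1 * a * d + (- + 1 * a * d + + 0)
      ≡⟨ cancel a d ⟩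
    + 0 ∎
    where
    term : Fin (suc (suc m)) → ℤ
    term i = sgn (toℕ i) * A i 0F * det (minorᵢ₀ i A)
    a d : ℤ
    a = A 1F 0F
    d = det (minorᵢ₀ 1F A)
    minor₀≗minor₁ : ∀ r c → minorᵢ₀ 0F A r c ≡ minorᵢ₀ 1F A r c
    minor₀≗minor₁ 0F          c = sym (row₀≡row₁ (Fin.suc c))
    minor₀≗minor₁ (Fin.suc r) c = refl
    term₀≡ : term 0F ≡ + 1 * a * d
    term₀≡ = cong₂ (λ a′ d′ → + 1 * a′ * d′) (row₀≡row₁ 0F) (det-cong minor₀≗minor₁)
    other-terms-vanish : sum (term ∘ Fin.suc ∘ Fin.suc) ≡ + 0
    other-terms-vanish = trans
      (sum-cong-≗ (λ i → let σa = sgn (2 ℕ.+ toℕ i) * A (Fin.suc (Fin.suc i)) 0F in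
        trans (cong (σa *_) (det-minorᵢ₀-equalRows₀₁ A row₀≡row₁ i)) (*-zeroʳ σa)))
      (sum-replicate-zero m)
    cancel : ∀ a d → + 1 * a * d + (- + 1 * a * d + + 0) ≡ + 0
    cancel = solve-∀

  det-minorᵢ₀-equalRows₀₁ : ∀ {m} (A : Matrix (suc (suc m))) → (∀ c → A 0F c ≡ A 1F c) →
    (i : Fin m) → det (minorᵢ₀ (Fin.suc (Fin.suc i)) A) ≡ + 0
  det-minorᵢ₀-equalRows₀₁ {suc m} A row₀≡row₁ i =
    det-equalRows₀₁ (minorᵢ₀ (Fin.suc (Fin.suc i)) A) (row₀≡row₁ ∘ Fin.suc)

det-linear-col₀ : ∀ {m} (Y Y₁ Y₂ : Matrix (suc m)) (s t : ℤ) →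
  (∀ r c → Y r (Fin.suc c) ≡ Y₁ r (Fin.suc c)) → (∀ r c → Y r (Fin.suc c) ≡ Y₂ r (Fin.suc c)) →
  (∀ r → Y r 0F ≡ s * Y₁ r 0F - t * Y₂ r 0F) →
  det Y ≡ s * det Y₁ - t * det Y₂
det-linear-col₀ {m} Y Y₁ Y₂ s t Y≗Y₁ Y≗Y₂ col₀ = begin
  det Y
    ≡⟨ det-expandCol₀ Y ⟩
  sum (λ i → σ i * Y i 0F * D i)
    ≡⟨ sum-cong-≗ (λ i → trans (cong (λ y → σ i * y * D i) (col₀ i))
                               (split (σ i) s t (Y₁ i 0F) (Y₂ i 0F) (D i))) ⟩
  sum (λ i → s * (σ i * Y₁ i 0F * D i) + - t * (σ i * Y₂ i 0F * D i))
    ≡⟨ ∑-distrib-+ (λ i → s * (σ i * Y₁ i 0F * D i)) (λ i → - t * (σ i * Y₂ i 0F * D i)) ⟩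
  sum (λ i → s * (σ i * Y₁ i 0F * D i)) + sum (λ i → - t * (σ i * Y₂ i 0F * D i))
    ≡⟨ cong₂ _+_ (*-distribˡ-sum s (λ i → σ i * Y₁ i 0F * D i))
                 (*-distribˡ-sum (- t) (λ i → σ i * Y₂ i 0F * D i)) ⟨
  s * sum (λ i → σ i * Y₁ i 0F * D i) + - t * sum (λ i → σ i * Y₂ i 0F * D i)
    ≡⟨ cong₂ (λ u v → s * u + - t * v) (expand Y₁ Y≗Y₁) (expand Y₂ Y≗Y₂) ⟩
  s * det Y₁ + - t * det Y₂
    ≡⟨ cong (_+_ (s * det Y₁)) (neg-distribˡ-* t (det Y₂)) ⟨
  s * det Y₁ - t * det Y₂ ∎
  where
  σ D : Fin (suc m) → ℤ
  σ i = sgn (toℕ i)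
  D i = det (minorᵢ₀ i Y)
  split : ∀ σ s t y₁ y₂ d → σ * (s * y₁ - t * y₂) * d ≡ s * (σ * y₁ * d) + - t * (σ * y₂ * d)
  split = solve-∀
  expand : ∀ Z → (∀ r c → Y r (Fin.suc c) ≡ Z r (Fin.suc c)) → sum (λ i → σ i * Z i 0F * D i) ≡ det Z
  expand Z Y≗Z = trans (sum-cong-≗ (λ i → cong (σ i * Z i 0F *_) (det-cong (λ r c → Y≗Z (punchIn i r) c))))
                       (sym (det-expandCol₀ Z))

det-scale-col₀ : ∀ {m} (Y Y′ : Matrix (suc m)) (s : ℤ) →
  (∀ r c → Y r (Fin.suc c) ≡ Y′ r (Fin.suc c)) → (∀ r → Y r 0F ≡ s * Y′ r 0F) → det Y ≡ s * det Y′
det-scale-col₀ Y Y′ s Y≗Y′ col₀ = trans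
  (det-linear-col₀ Y Y′ Y′ s (+ 0) Y≗Y′ Y≗Y′ (λ r → trans (col₀ r) (drop-zero s (Y′ r 0F))))
  (sym (drop-zero s (det Y′)))
  where
  drop-zero : ∀ s y → s * y ≡ s * y - + 0 * y
  drop-zero = solve-∀

withRow₀ : ∀ {m} → (Fin (suc m) → ℤ) → Matrix (suc m) → Matrix (suc m)
withRow₀ v A 0F          c = v c
withRow₀ v A (Fin.suc r) c = A (Fin.suc r) c

rowCombination₀₁ : ∀ {m} → ℤ → ℤ → Matrix (suc (suc m)) → Fin (suc (suc m)) → ℤ
rowCombination₀₁ p q A c = p * A 0F c - q * A 1F c

det-withRowCombination₀₁ : ∀ {m} (p q : ℤ) (A : Matrix (suc (suc m))) →
  p * det A ≡ det (withRow₀ (rowCombination₀₁ p q A) A)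
det-withRowCombination₀₁ {m} p q A = begin
  p * det A
    ≡⟨ add-zero (p * det A) q ⟩
  p * det A + - q * + 0
    ≡⟨ cong₂ (λ u v → p * u + - q * v) (det-expandRow₀ A)
         (trans (sym (det-equalRows₀₁ (withRow₀ (A 1F) A) (λ c → refl)))
                (det-expandRow₀ (withRow₀ (A 1F) A))) ⟩
  p * sum (λ j → σ j * A 0F j * D j) + - q * sum (λ j → σ j * A 1F j * D j)
    ≡⟨ cong₂ _+_ (*-distribˡ-sum p (λ j → σ j * A 0F j * D j))
                 (*-distribˡ-sum (- q) (λ j → σ j * A 1F j * D j)) ⟩
  sum (λ j → p * (σ j * A 0F j * D j)) + sum (λ j → - q * (σ j * A 1F j * D j))
    ≡⟨ ∑-distrib-+ (λ j → p * (σ j * A 0F j * D j)) (λ j → - q * (σ j * A 1F j * D j)) ⟨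
  sum (λ j → p * (σ j * A 0F j * D j) + - q * (σ j * A 1F j * D j))
    ≡⟨ sum-cong-≗ (λ j → combine p q (σ j) (A 0F j) (A 1F j) (D j)) ⟩
  sum (λ j → σ j * rowCombination₀₁ p q A j * D j)
    ≡⟨ det-expandRow₀ (withRow₀ (rowCombination₀₁ p q A) A) ⟨
  det (withRow₀ (rowCombination₀₁ p q A) A) ∎
  where
  σ D : Fin (suc (suc m)) → ℤ
  σ j = sgn (toℕ j)
  D j = det (minor₀ⱼ j A)
  add-zero : ∀ a q → a ≡ a + - q * + 0
  add-zero = solve-∀
  combine : ∀ p q σ a b d → p * (σ * a * d) + - q * (σ * b * d) ≡ σ * (p * a - q * b) * d
  combine = solve-∀

det-sparseRow₀ : ∀ {m} (A : Matrix (suc (suc m))) → (∀ c → A 0F (Fin.suc (Fin.suc c)) ≡ + 0) →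
  det A ≡ A 0F 0F * det (minor₀ⱼ 0F A) - A 0F 1F * det (minor₀ⱼ 1F A)
det-sparseRow₀ {m} A row₀-sparse = begin
  det A                                                 ≡⟨ det-expandRow₀ A ⟩
  term 0F + (term 1F + sum (term ∘ Fin.suc ∘ Fin.suc))  ≡⟨ cong (λ s → term 0F + (term 1F + s)) other-terms-vanish ⟩
  term 0F + (term 1F + + 0)                             ≡⟨ two-terms (A 0F 0F) (A 0F 1F) (D 0F) (D 1F) ⟩
  A 0F 0F * D 0F - A 0F 1F * D 1F                       ∎
  where
  D : Fin (suc (suc m)) → ℤ
  D j = det (minor₀ⱼ j A)
  term : Fin (suc (suc m)) → ℤ
  term j = sgn (toℕ j) * A 0F j * D j
  other-terms-vanish : sum (term ∘ Fin.suc ∘ Fin.suc) ≡ + 0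
  other-terms-vanish = trans
    (sum-cong-≗ (λ j → let σ = sgn (2 ℕ.+ toℕ j) ; D′ = D (Fin.suc (Fin.suc j)) in
      trans (cong (λ a → σ * a * D′) (row₀-sparse j)) (vanish σ D′)))
    (sum-replicate-zero m)
    where
    vanish : ∀ σ d → σ * + 0 * d ≡ + 0
    vanish = solve-∀
  two-terms : ∀ a b d e → + 1 * a * d + (- + 1 * b * e + + 0) ≡ a * d - b * e
  two-terms = solve-∀

-- If p·row₀ − q·row₁ vanishes beyond column 1, expanding p·det A along it leaves two minors that
-- differ only in column 0; mergeRows₀₁ adds them up in that column.
mergeRows₀₁ : ∀ {m} → ℤ → ℤ → Matrix (suc (suc m)) → Matrix (suc m)
mergeRows₀₁ p q A r 0F =
  rowCombination₀₁ p q A 0F * A (Fin.suc r) 1F - rowCombination₀₁ p q A 1F * A (Fin.suc r) 0F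
mergeRows₀₁ p q A r (Fin.suc c) = A (Fin.suc r) (Fin.suc (Fin.suc c))

det-mergeRows₀₁ : ∀ {m} (p q : ℤ) (A : Matrix (suc (suc m))) →
  (∀ c → p * A 0F (Fin.suc (Fin.suc c)) ≡ q * A 1F (Fin.suc (Fin.suc c))) →
  p * det A ≡ det (mergeRows₀₁ p q A)
det-mergeRows₀₁ {m} p q A rows-proportional = begin
  p * det A
    ≡⟨ det-withRowCombination₀₁ p q A ⟩
  det (withRow₀ v A)
    ≡⟨ det-sparseRow₀ (withRow₀ v A) (λ c → trans (cong (_- q * A 1F (Fin.suc (Fin.suc c))) (rows-proportional c))
                                                    (+-inverseʳ (q * A 1F (Fin.suc (Fin.suc c))))) ⟩
  v 0F * det (minor₀ⱼ 0F A) - v 1F * det (minor₀ⱼ 1F A)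
    ≡⟨ det-linear-col₀ (mergeRows₀₁ p q A) (minor₀ⱼ 0F A) (minor₀ⱼ 1F A) (v 0F) (v 1F)
         (λ r c → refl) (λ r c → refl) (λ r → refl) ⟨
  det (mergeRows₀₁ p q A) ∎
  where
  v : Fin (suc (suc m)) → ℤ
  v = rowCombination₀₁ p q A

-- Unlike xI-_at_, which tests the diagonal with _≟_, this reduces at (suc r, suc c); the row
-- reductions on x·I − A below are then checked entrywise by refl.
scalar : ℤ → ∀ {m} → Matrix m
scalar x 0F          0F          = x
scalar x 0F          (Fin.suc c) = + 0
scalar x (Fin.suc r) 0F          = + 0
scalar x (Fin.suc r) (Fin.suc c) = scalar x r c

scalar-diagonal : ∀ {m} x (r : Fin m) → scalar x r r ≡ x
scalar-diagonal x 0F          = refl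
scalar-diagonal x (Fin.suc r) = scalar-diagonal x r

scalar-offDiagonal : ∀ {m} x {r c : Fin m} → r ≢ c → scalar x r c ≡ + 0
scalar-offDiagonal x {0F}        {0F}        r≢c = contradiction refl r≢c
scalar-offDiagonal x {0F}        {Fin.suc c} r≢c = refl
scalar-offDiagonal x {Fin.suc r} {0F}        r≢c = refl
scalar-offDiagonal x {Fin.suc r} {Fin.suc c} r≢c = scalar-offDiagonal x (r≢c ∘ cong Fin.suc)

xI-≗scalar- : ∀ {m} (A : Matrix m) (x : ℤ) r c → (xI- A at x) r c ≡ scalar x r c - A r c
xI-≗scalar- A x r c with r ≟ c
... | yes refl = cong (_- A r r) (sym (scalar-diagonal x r))
... | no r≢c   = cong (_- A r c) (sym (scalar-offDiagonal x r≢c))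

module CharBlock (x : ℤ) (κ : Bool → Bool → ℤ) where

  α β β′ γ : ℤ
  α  = κ true  true
  β  = κ true  false
  β′ = κ false true
  γ  = κ false false

  inFirstBlock : ℕ → ∀ {m} → Fin m → Bool
  inFirstBlock a r = toℕ r <ᵇ a

  -- The weight w on column 0 accounts for the first-block rows already collapsed into row 0.
  charBlock : ∀ {m} → ℕ → ℤ → Matrix m
  charBlock a w r c@0F          = scalar x r c - w * κ (inFirstBlock a r) (inFirstBlock a c)
  charBlock a w r c@(Fin.suc _) = scalar x r c - κ (inFirstBlock a r) (inFirstBlock a c)

  xI-≗charBlock : ∀ {m} a (A : Matrix m) → (∀ r c → A r c ≡ κ (inFirstBlock a r) (inFirstBlock a c)) →
    ∀ r c → (xI- A at x) r c ≡ charBlock a (+ 1) r c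
  xI-≗charBlock a A A≗κ r c@0F =
    trans (xI-≗scalar- A x r c) (cong (λ e → scalar x r c - e) (trans (A≗κ r c) (sym (*-identityˡ _))))
  xI-≗charBlock a A A≗κ r c@(Fin.suc _) =
    trans (xI-≗scalar- A x r c) (cong (λ e → scalar x r c - e) (A≗κ r c))

  -- det (xI − Q) for the quotient matrix Q = [[K α, B β], [K β′, B γ]] of blocks of sizes K and B.
  quotientCharPoly : ℤ → ℤ → ℤ
  quotientCharPoly K B = (x - K * α) * (x - B * γ) - K * B * β * β′

  det-charBlock-peel : ∀ {m} a w →
    det (charBlock {suc (suc m)} (suc (suc a)) w) ≡ x * det (charBlock {suc m} (suc a) (w + + 1))
  det-charBlock-peel {m} a w = begin
    det A
      ≡⟨ *-identityˡ _ ⟨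
    + 1 * det A
      ≡⟨ det-mergeRows₀₁ (+ 1) (+ 1) A (λ c → refl) ⟩
    det (mergeRows₀₁ (+ 1) (+ 1) A)
      ≡⟨ det-scale-col₀ (mergeRows₀₁ (+ 1) (+ 1) A) A′ x (λ r c → refl)
           (λ r → merged x w α (scalar x r 0F) (κ (inFirstBlock (suc a) r) true)) ⟩
    x * det A′ ∎
    where
    A : Matrix (suc (suc m))
    A = charBlock (suc (suc a)) w
    A′ : Matrix (suc m)
    A′ = charBlock (suc a) (w + + 1)
    merged : ∀ x w α d k →
      (+ 1 * (x - w * α) - + 1 * (+ 0 - w * α)) * (d - k) - (+ 1 * (+ 0 - α) - + 1 * (x - α)) * (+ 0 - w * k)
        ≡ x * (d - (w + + 1) * k)
    merged = solve-∀

  det-charBlock-peelFirstBlock : ∀ a b w →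
    det (charBlock {suc a ℕ.+ suc b} (suc a) w) ≡ x ^ a * det (charBlock {suc (suc b)} 1 (w + + a))
  det-charBlock-peelFirstBlock zero    b w =
    sym (trans (*-identityˡ _) (cong (λ w → det (charBlock {suc (suc b)} 1 w)) (+-identityʳ w)))
  det-charBlock-peelFirstBlock (suc a) b w = begin
    det (charBlock {suc (suc a) ℕ.+ suc b} (suc (suc a)) w)
      ≡⟨ det-charBlock-peel {a ℕ.+ suc b} a w ⟩
    x * det (charBlock {suc a ℕ.+ suc b} (suc a) (w + + 1))
      ≡⟨ cong (x *_) (det-charBlock-peelFirstBlock a b (w + + 1)) ⟩
    x * (x ^ a * det (charBlock {suc (suc b)} 1 (w + + 1 + + a)))
      ≡⟨ *-assoc x (x ^ a) _ ⟨
    x ^ suc a * det (charBlock {suc (suc b)} 1 (w + + 1 + + a))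
      ≡⟨ cong (λ w → x ^ suc a * det (charBlock {suc (suc b)} 1 w)) (+-assoc w (+ 1) (+ a)) ⟩
    x ^ suc a * det (charBlock {suc (suc b)} 1 (w + + suc a)) ∎

  charConst : ∀ {m} → ℤ → ℤ → Matrix m
  charConst s t r 0F          = s * (scalar x r 0F - γ) - t
  charConst s t r (Fin.suc c) = scalar x r (Fin.suc c) - γ

  det-charConst : ∀ b s t → det (charConst {suc b} s t) ≡ x ^ b * (s * (x - + suc b * γ) - t)
  det-charConst zero    s t = one-by-one x γ s t
    where
    one-by-one : ∀ x γ s t → + 1 * (s * (x - γ) - t) * + 1 + + 0 ≡ + 1 * (s * (x - + 1 * γ) - t)
    one-by-one = solve-∀
  det-charConst (suc b) s t = begin
    det A
      ≡⟨ *-identityˡ _ ⟨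
    + 1 * det A
      ≡⟨ det-mergeRows₀₁ (+ 1) (+ 1) A (λ c → refl) ⟩
    det (mergeRows₀₁ (+ 1) (+ 1) A)
      ≡⟨ det-cong merged≗charConst ⟩
    det (charConst {suc b} s′ t′)
      ≡⟨ det-charConst b s′ t′ ⟩
    x ^ b * (s′ * (x - + suc b * γ) - t′)
      ≡⟨ step x γ s t (+ b) (x ^ b) ⟩
    x ^ suc b * (s * (x - + suc (suc b) * γ) - t) ∎
    where
    A : Matrix (suc (suc b))
    A = charConst s t
    s′ t′ : ℤ
    s′ = rowCombination₀₁ (+ 1) (+ 1) A 0F
    t′ = rowCombination₀₁ (+ 1) (+ 1) A 1F * A 1F 0F
    merged≗charConst : ∀ r c → mergeRows₀₁ (+ 1) (+ 1) A r c ≡ charConst s′ t′ r c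
    merged≗charConst r 0F          = refl
    merged≗charConst r (Fin.suc c) = refl
    step : ∀ x γ s t b X →
      X * ((+ 1 * (s * (x - γ) - t) - + 1 * (s * (+ 0 - γ) - t)) * (x - (+ 1 + b) * γ)
           - (+ 1 * (+ 0 - γ) - + 1 * (x - γ)) * (s * (+ 0 - γ) - t))
        ≡ x * X * (s * (x - (+ 1 + (+ 1 + b)) * γ) - t)
    step = solve-∀

  det-charBlock-singleFirst : ∀ b w →
    γ * det (charBlock {suc (suc b)} 1 w) ≡ γ * (x ^ b * quotientCharPoly w (+ suc b))
  det-charBlock-singleFirst b w = begin
    γ * det A
      ≡⟨ det-mergeRows₀₁ γ β A (λ c → proportional β γ) ⟩
    det (mergeRows₀₁ γ β A)
      ≡⟨ det-cong merged≗charConst ⟩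
    det (charConst {suc b} s t)
      ≡⟨ det-charConst b s t ⟩
    x ^ b * (s * (x - + suc b * γ) - t)
      ≡⟨ factor x w α β β′ γ (+ suc b) (x ^ b) ⟩
    γ * (x ^ b * quotientCharPoly w (+ suc b)) ∎
    where
    A : Matrix (suc (suc b))
    A = charBlock 1 w
    proportional : ∀ β γ → γ * (+ 0 - β) ≡ β * (+ 0 - γ)
    proportional = solve-∀
    s t : ℤ
    s = rowCombination₀₁ γ β A 0F
    t = rowCombination₀₁ γ β A 1F * A 1F 0F
    merged≗charConst : ∀ r c → mergeRows₀₁ γ β A r c ≡ charConst s t r c
    merged≗charConst r 0F          = refl
    merged≗charConst r (Fin.suc c) = refl
    factor : ∀ x w α β β′ γ B X →
      X * ((γ * (x - w * α) - β * (+ 0 - w * β′)) * (x - B * γ)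
           - (γ * (+ 0 - β) - β * (x - γ)) * (+ 0 - w * β′))
        ≡ γ * (X * ((x - w * α) * (x - B * γ) - w * B * β * β′))
    factor = solve-∀

  -- Collapsing the last first-block row against the second block scales it by γ.
  det-charBlock : ∀ a b w .{{_ : ℤ.NonZero γ}} →
    det (charBlock {suc a ℕ.+ suc b} (suc a) w) ≡ x ^ a * x ^ b * quotientCharPoly (w + + a) (+ suc b)
  det-charBlock a b w = *-cancelˡ-≡ γ _ _ (begin
    γ * det (charBlock {suc a ℕ.+ suc b} (suc a) w)
      ≡⟨ cong (γ *_) (det-charBlock-peelFirstBlock a b w) ⟩
    γ * (x ^ a * det (charBlock {suc (suc b)} 1 (w + + a)))
      ≡⟨ x*[y*z]≡y*[x*z] γ (x ^ a) _ ⟩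
    x ^ a * (γ * det (charBlock {suc (suc b)} 1 (w + + a)))
      ≡⟨ cong (x ^ a *_) (det-charBlock-singleFirst b (w + + a)) ⟩
    x ^ a * (γ * (x ^ b * χ))
      ≡⟨ regroup γ (x ^ a) (x ^ b) χ ⟩
    γ * (x ^ a * x ^ b * χ) ∎)
    where
    χ : ℤ
    χ = quotientCharPoly (w + + a) (+ suc b)
    x*[y*z]≡y*[x*z] : ∀ a b c → a * (b * c) ≡ b * (a * c)
    x*[y*z]≡y*[x*z] = solve-∀
    regroup : ∀ g a b c → a * (g * (b * c)) ≡ g * (a * b * c)
    regroup = solve-∀

ordered? : ∀ {n} (p : Fin n × Fin n) → Dec (toℕ (proj₁ p) ℕ.< toℕ (proj₂ p))
ordered? p = toℕ (proj₁ p) ℕ.<? toℕ (proj₂ p)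

shift : ∀ {n} → Fin n × Fin n → Fin (suc n) × Fin (suc n)
shift = Product.map Fin.suc Fin.suc

pairsWithCentre : ∀ n → List (Fin (suc n) × Fin (suc n))
pairsWithCentre n = List.map (0F ,_) (List.tabulate Fin.suc)

filter-row-shift : ∀ {n} (i : Fin n) ys →
  filter ordered? (List.map (Fin.suc i ,_) (List.map Fin.suc ys)) ≡ List.map shift (filter ordered? (List.map (i ,_) ys))
filter-row-shift i [] = refl
filter-row-shift i (y ∷ ys) with toℕ i <ᵇ toℕ y
... | true  = cong (_ ∷_) (filter-row-shift i ys)
... | false = filter-row-shift i ys

filter-product-shift : ∀ {n} (xs ys : List (Fin n)) →
  filter ordered? (cartesianProduct (List.map Fin.suc xs) (0F ∷ List.map Fin.suc ys))
    ≡ List.map shift (filter ordered? (cartesianProduct xs ys))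
filter-product-shift []       ys = refl
filter-product-shift {n} (i ∷ xs) ys = begin
  filter ordered? (List.map (Fin.suc i ,_) (0F ∷ sys) ++ cartesianProduct (List.map Fin.suc xs) (0F ∷ sys))
    ≡⟨ filter-++ ordered? (List.map (Fin.suc i ,_) (0F ∷ sys)) _ ⟩
  filter ordered? (List.map (Fin.suc i ,_) sys) ++ filter ordered? (cartesianProduct (List.map Fin.suc xs) (0F ∷ sys))
    ≡⟨ cong₂ _++_ (filter-row-shift i ys) (filter-product-shift xs ys) ⟩
  List.map shift (filter ordered? (List.map (i ,_) ys)) ++ List.map shift (filter ordered? (cartesianProduct xs ys))
    ≡⟨ map-++ shift (filter ordered? (List.map (i ,_) ys)) _ ⟨
  List.map shift (filter ordered? (List.map (i ,_) ys) ++ filter ordered? (cartesianProduct xs ys))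
    ≡⟨ cong (List.map shift) (filter-++ ordered? (List.map (i ,_) ys) _) ⟨
  List.map shift (filter ordered? (cartesianProduct (i ∷ xs) ys)) ∎
  where
  sys : List (Fin (suc n))
  sys = List.map Fin.suc ys

pairs-suc : ∀ n → pairs (suc n) ≡ pairsWithCentre n ++ List.map shift (pairs n)
pairs-suc n = begin
  filter ordered? (List.map (0F ,_) (0F ∷ suc-tabulate) ++ cartesianProduct suc-tabulate (0F ∷ suc-tabulate))
    ≡⟨ filter-++ ordered? (List.map (0F ,_) (0F ∷ suc-tabulate)) _ ⟩
  filter ordered? (pairsWithCentre n) ++ filter ordered? (cartesianProduct suc-tabulate (0F ∷ suc-tabulate))
    ≡⟨ cong₂ _++_ (filter-all ordered? (map⁺ (tabulate⁺ (λ _ → ℕ.s≤s ℕ.z≤n)))) (begin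
         filter ordered? (cartesianProduct suc-tabulate (0F ∷ suc-tabulate))
           ≡⟨ cong (λ us → filter ordered? (cartesianProduct us (0F ∷ us))) (map-tabulate (λ i → i) Fin.suc) ⟨
         filter ordered? (cartesianProduct (List.map Fin.suc (allFin n)) (0F ∷ List.map Fin.suc (allFin n)))
           ≡⟨ filter-product-shift (allFin n) (allFin n) ⟩
         List.map shift (pairs n) ∎) ⟩
  pairsWithCentre n ++ List.map shift (pairs n) ∎
  where
  suc-tabulate : List (Fin (suc n))
  suc-tabulate = List.tabulate Fin.suc

length-pairsWithCentre : ∀ n → length (pairsWithCentre n) ≡ n
length-pairsWithCentre n = trans (length-map (0F ,_) (List.tabulate {n = n} Fin.suc)) (length-tabulate Fin.suc)

P-suc : ∀ n → P (suc n) ≡ n ℕ.+ P n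
P-suc n = begin
  length (pairs (suc n))
    ≡⟨ cong length (pairs-suc n) ⟩
  length (pairsWithCentre n ++ List.map shift (pairs n))
    ≡⟨ length-++ (pairsWithCentre n) ⟩
  length (pairsWithCentre n) ℕ.+ length (List.map shift (pairs n))
    ≡⟨ cong₂ ℕ._+_ (length-pairsWithCentre n) (length-map shift (pairs n)) ⟩
  n ℕ.+ P n ∎

suc-C2 : ∀ m → suc m C 2 ≡ m ℕ.+ m C 2
suc-C2 m = trans (sym (nCk+nC[k+1]≡[n+1]C[k+1] m 1)) (cong (ℕ._+ m C 2) (nC1≡n m))

double-C2 : ∀ m → 2 ℕ.* (suc m C 2) ≡ suc m ℕ.* m
double-C2 zero    = refl
double-C2 (suc m) = begin
  2 ℕ.* (suc (suc m) C 2)          ≡⟨ cong (2 ℕ.*_) (suc-C2 (suc m)) ⟩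
  2 ℕ.* (suc m ℕ.+ suc m C 2)      ≡⟨ ℕ.*-distribˡ-+ 2 (suc m) (suc m C 2) ⟩
  2 ℕ.* suc m ℕ.+ 2 ℕ.* (suc m C 2) ≡⟨ cong (2 ℕ.* suc m ℕ.+_) (double-C2 m) ⟩
  2 ℕ.* suc m ℕ.+ suc m ℕ.* m      ≡⟨ ℕ-solve m ⟩
  suc (suc m) ℕ.* suc m ∎
  where
  ℕ-solve : ∀ m → 2 ℕ.* suc m ℕ.+ suc m ℕ.* m ≡ suc (suc m) ℕ.* suc m
  ℕ-solve = ℕ-Solver.solve-∀

P≡C2 : ∀ n → P n ≡ n C 2
P≡C2 zero    = refl
P≡C2 (suc n) = trans (P-suc n) (trans (cong (n ℕ.+_) (P≡C2 n)) (sym (suc-C2 n)))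

pair-ordered : ∀ n (r : Fin (P n)) → toℕ (proj₁ (pair n r)) ℕ.< toℕ (proj₂ (pair n r))
pair-ordered n r = All.lookup (all-filter ordered? (cartesianProduct (allFin n) (allFin n))) (∈-lookup r)

lookup-++-<ᵇ : ∀ {A : Set} (b : A → Bool) (xs ys : List A) →
  All (λ a → b a ≡ true) xs → All (λ a → b a ≡ false) ys →
  ∀ r → b (lookup (xs ++ ys) r) ≡ (toℕ r <ᵇ length xs)
lookup-++-<ᵇ b []       ys []         ys-false r           = All.lookup ys-false (∈-lookup r)
lookup-++-<ᵇ b (x ∷ xs) ys (bx ∷ _)   ys-false 0F          = bx
lookup-++-<ᵇ b (x ∷ xs) ys (_ ∷ xs-true) ys-false (Fin.suc r) = lookup-++-<ᵇ b xs ys xs-true ys-false r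

isCentre : ∀ {n} → Fin n → Bool
isCentre u = toℕ u ≡ᵇ 0

pair-isCentre : ∀ n (r : Fin (P (suc n))) → isCentre (proj₁ (pair (suc n) r)) ≡ (toℕ r <ᵇ n)
pair-isCentre n = classify (pairs-suc n)
  where
  classify : ∀ {L} → L ≡ pairsWithCentre n ++ List.map shift (pairs n) →
    (r : Fin (length L)) → isCentre (proj₁ (lookup L r)) ≡ (toℕ r <ᵇ n)
  classify refl r = trans
    (lookup-++-<ᵇ (isCentre ∘ proj₁) (pairsWithCentre n) _
       (map⁺ (All.universal (λ _ → refl) _)) (map⁺ (All.universal (λ _ → refl) _)) r)
    (cong (toℕ r <ᵇ_) (length-pairsWithCentre n))

leafIndicator : Bool → ℕ
leafIndicator true  = 0
leafIndicator false = 1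

leaf : ∀ {n} → Fin n → ℕ
leaf u = leafIndicator (isCentre u)

<⇒leaf≡1 : ∀ {n} {w x : Fin n} → toℕ w ℕ.< toℕ x → leaf x ≡ 1
<⇒leaf≡1 {x = Fin.suc _} _ = refl

starDist-≤ : ∀ {n} (u v : Fin n) → starDist n u v ℕ.≤ leaf u ℕ.+ leaf v
starDist-≤ 0F          0F          = ℕ.z≤n
starDist-≤ 0F          (Fin.suc v) = ℕ.≤-refl
starDist-≤ (Fin.suc u) 0F          = ℕ.≤-refl
starDist-≤ (Fin.suc u) (Fin.suc v) with Fin.suc u ≟ Fin.suc v
... | yes _ = ℕ.z≤n
... | no  _ = ℕ.≤-refl

starDist-distinct : ∀ {n} (u v : Fin n) → u ≢ v → starDist n u v ≡ leaf u ℕ.+ leaf v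
starDist-distinct 0F 0F u≢v = contradiction refl u≢v
starDist-distinct 0F (Fin.suc v) u≢v = refl
starDist-distinct (Fin.suc u) 0F u≢v = refl
starDist-distinct (Fin.suc u) (Fin.suc v) u≢v with Fin.suc u ≟ Fin.suc v
... | yes u≡v = contradiction u≡v u≢v
... | no  _   = refl

star-fourPoint : ∀ {n} {w x y z : Fin n} → toℕ w ℕ.< toℕ x → toℕ y ℕ.< toℕ z →
  let d = starDist n in
  ((d w x ℕ.+ d y z) ⊔ (d w y ℕ.+ d x z)) ⊔ (d w z ℕ.+ d x y) ≡ 2 ℕ.+ leaf w ℕ.+ leaf y
star-fourPoint {n} {w} {x} {y} {z} w<x y<z = begin
  ((d w x ℕ.+ d y z) ⊔ (d w y ℕ.+ d x z)) ⊔ (d w z ℕ.+ d x y)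
    ≡⟨ cong (λ s → (s ⊔ (d w y ℕ.+ d x z)) ⊔ (d w z ℕ.+ d x y)) pairing₁ ⟩
  (T ⊔ (d w y ℕ.+ d x z)) ⊔ (d w z ℕ.+ d x y)
    ≡⟨ cong (_⊔ (d w z ℕ.+ d x y)) (ℕ.m≥n⇒m⊔n≡m pairing₂≤) ⟩
  T ⊔ (d w z ℕ.+ d x y)
    ≡⟨ ℕ.m≥n⇒m⊔n≡m pairing₃≤ ⟩
  T ∎
  where
  d : Fin n → Fin n → ℕ
  d = starDist n
  T : ℕ
  T = 2 ℕ.+ leaf w ℕ.+ leaf y
  lx lz : ℕ
  lx = leaf x
  lz = leaf z
  lx≡1 : lx ≡ 1
  lx≡1 = <⇒leaf≡1 w<x
  lz≡1 : lz ≡ 1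
  lz≡1 = <⇒leaf≡1 y<z
  pairing₁ : d w x ℕ.+ d y z ≡ T
  pairing₁ = begin
    d w x ℕ.+ d y z
      ≡⟨ cong₂ ℕ._+_ (starDist-distinct w x (λ { refl → ℕ.<-irrefl refl w<x }))
                     (starDist-distinct y z (λ { refl → ℕ.<-irrefl refl y<z })) ⟩
    leaf w ℕ.+ lx ℕ.+ (leaf y ℕ.+ lz)
      ≡⟨ cong₂ (λ p q → leaf w ℕ.+ p ℕ.+ (leaf y ℕ.+ q)) lx≡1 lz≡1 ⟩
    leaf w ℕ.+ 1 ℕ.+ (leaf y ℕ.+ 1)
      ≡⟨ arith₁ (leaf w) (leaf y) ⟩
    T ∎
    where
    arith₁ : ∀ a b → a ℕ.+ 1 ℕ.+ (b ℕ.+ 1) ≡ 2 ℕ.+ a ℕ.+ b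
    arith₁ = ℕ-Solver.solve-∀
  pairing₂≤ : d w y ℕ.+ d x z ℕ.≤ T
  pairing₂≤ = ℕ.≤-trans (ℕ.+-mono-≤ (starDist-≤ w y) (starDist-≤ x z)) (ℕ.≤-reflexive (begin
    leaf w ℕ.+ leaf y ℕ.+ (lx ℕ.+ lz)  ≡⟨ cong₂ (λ p q → leaf w ℕ.+ leaf y ℕ.+ (p ℕ.+ q)) lx≡1 lz≡1 ⟩
    leaf w ℕ.+ leaf y ℕ.+ 2            ≡⟨ ℕ.+-comm (leaf w ℕ.+ leaf y) 2 ⟩
    2 ℕ.+ (leaf w ℕ.+ leaf y)          ≡⟨ ℕ.+-assoc 2 (leaf w) (leaf y) ⟨
    T ∎))
  pairing₃≤ : d w z ℕ.+ d x y ℕ.≤ T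
  pairing₃≤ = ℕ.≤-trans (ℕ.+-mono-≤ (starDist-≤ w z) (starDist-≤ x y)) (ℕ.≤-reflexive (begin
    leaf w ℕ.+ lz ℕ.+ (lx ℕ.+ leaf y)  ≡⟨ cong₂ (λ p q → leaf w ℕ.+ p ℕ.+ (q ℕ.+ leaf y)) lz≡1 lx≡1 ⟩
    leaf w ℕ.+ 1 ℕ.+ (1 ℕ.+ leaf y)    ≡⟨ arith₃ (leaf w) (leaf y) ⟩
    T ∎))
    where
    arith₃ : ∀ a b → a ℕ.+ 1 ℕ.+ (1 ℕ.+ b) ≡ 2 ℕ.+ a ℕ.+ b
    arith₃ = ℕ-Solver.solve-∀

-- Indexed by whether the smaller vertex of each pair is the centre; the larger one is always a leaf.
starBlock : Bool → Bool → ℤ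
starBlock s t = + (2 ℕ.+ leafIndicator s ℕ.+ leafIndicator t)

Max4PC-star : ∀ n (r c : Fin (P (suc n))) →
  Max4PC (suc n) (starDist (suc n)) r c ≡ starBlock (toℕ r <ᵇ n) (toℕ c <ᵇ n)
Max4PC-star n r c = trans
  (cong +_ (star-fourPoint (pair-ordered (suc n) r) (pair-ordered (suc n) c)))
  (cong₂ starBlock (pair-isCentre n r) (pair-isCentre n c))

star-quotientCharPoly : ∀ x m →
  CharBlock.quotientCharPoly x starBlock (+ suc m) (+ (suc m C 2))
    ≡ x ^ 2 - + 2 * (+ suc m) ^ 2 * x - + suc m * + (suc m C 2)
star-quotientCharPoly x m = begin
  (x - K * + 2) * (x - B * + 4) - K * B * + 3 * + 3
    ≡⟨ expand x (+ m) B ⟩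
  x * x - (+ 2 * K + + 2 * (+ 2 * B)) * x - K * B
    ≡⟨ cong (λ e → x * x - (+ 2 * K + + 2 * e) * x - K * B) 2B≡K[K-1] ⟩
  x * x - (+ 2 * K + + 2 * (K * + m)) * x - K * B
    ≡⟨ collect x (+ m) B ⟩
  x * x - + 2 * (K * K) * x - K * B
    ≡⟨ cong₂ (λ s t → s - + 2 * t * x - K * B) (square x) (square K) ⟨
  x ^ 2 - + 2 * K ^ 2 * x - K * B ∎
  where
  K B : ℤ
  K = + suc m
  B = + (suc m C 2)
  2B≡K[K-1] : + 2 * B ≡ K * + m
  2B≡K[K-1] = trans (sym (pos-* 2 (suc m C 2))) (trans (cong +_ (double-C2 m)) (pos-* (suc m) m))
  square : ∀ i → i ^ 2 ≡ i * i
  square i = cong (i *_) (^-identityʳ i)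
  expand : ∀ y k c → (y - (+ 1 + k) * + 2) * (y - c * + 4) - (+ 1 + k) * c * + 3 * + 3
                       ≡ y * y - (+ 2 * (+ 1 + k) + + 2 * (+ 2 * c)) * y - (+ 1 + k) * c
  expand = solve-∀
  collect : ∀ y k c → y * y - (+ 2 * (+ 1 + k) + + 2 * ((+ 1 + k) * k)) * y - (+ 1 + k) * c
                        ≡ y * y - + 2 * ((+ 1 + k) * (+ 1 + k)) * y - (+ 1 + k) * c
  collect = solve-∀

theorem5p3 : (n : ℕ) → 3 ≤ n → (x : ℤ) →
    det (xI- Max4PC n (starDist n) at x)
    ≡ (x ^ ((n C 2) ∸ 2)) * ((x ^ 2) - (+ 2) * (+ (n ∸ 1)) ^ 2 * x - (+ (n ∸ 1)) * (+ ((n ∸ 1) C 2)))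
theorem5p3 (suc (suc (suc k))) (ℕ.s≤s (ℕ.s≤s (ℕ.s≤s _))) x = begin
  det (xI- Max4PC n (starDist n) at x)
    ≡⟨ det-cong (xI-≗charBlock (suc (suc k)) _ (Max4PC-star (suc (suc k)))) ⟩
  det (charBlock {P n} (suc (suc k)) (+ 1))
    ≡⟨ det-charBlock-of-size (trans (P≡C2 n) n-C2) ⟩
  x ^ suc k * x ^ b * quotientCharPoly (+ suc (suc k)) (+ suc b)
    ≡⟨ cong₂ _*_ (sym (^-distribˡ-+-* x (suc k) b))
                 (cong (quotientCharPoly (+ suc (suc k)) ∘ +_) (sym [k+2]C2)) ⟩
  x ^ (suc k ℕ.+ b) * quotientCharPoly (+ suc (suc k)) (+ (suc (suc k) C 2))
    ≡⟨ cong₂ _*_ (cong (x ^_) exponent) (star-quotientCharPoly x (suc k)) ⟩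
  (x ^ ((n C 2) ∸ 2)) * ((x ^ 2) - (+ 2) * (+ (n ∸ 1)) ^ 2 * x - (+ (n ∸ 1)) * (+ ((n ∸ 1) C 2))) ∎
  where
  open CharBlock x starBlock
  n b : ℕ
  n = suc (suc (suc k))
  b = k ℕ.+ suc k C 2
  [k+2]C2 : suc (suc k) C 2 ≡ suc b
  [k+2]C2 = suc-C2 (suc k)
  n-C2 : n C 2 ≡ suc (suc k) ℕ.+ suc b
  n-C2 = trans (suc-C2 (suc (suc k))) (cong (suc (suc k) ℕ.+_) [k+2]C2)
  exponent : suc k ℕ.+ b ≡ n C 2 ∸ 2
  exponent = trans (sym (ℕ.+-suc k b)) (cong (_∸ 2) (sym n-C2))
  det-charBlock-of-size : ∀ {m} → m ≡ suc (suc k) ℕ.+ suc b →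
    det (charBlock {m} (suc (suc k)) (+ 1)) ≡ x ^ suc k * x ^ b * quotientCharPoly (+ suc (suc k)) (+ suc b)
  det-charBlock-of-size refl = det-charBlock (suc k) b (+ 1)
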